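{- Consider a red/blue coloring of the vertices of the grid $\boxplus_{m\times n}$ that contains no cross-structure. Suppose $a,w,b$ are three consecutive vertices in a row or in a column of the grid, with $a$ and $b$ red and $w$ blue. Suppose further that $a$ and $b$ belong to different red regions, at least one of which is an island. Then: - $w$ is disposable for its (blue) region; - recoloring $w$ red creates no cross-structure; - recoloring $w$ red does not increase the degree of the outer-face dual vertex $v_0^*$.
   Context: Colorings and regions. - $\boxplus_{m\times n}$ is the $m\times n$ grid graph with its standard planar embedding. - A coloring assigns red or blue to each vertex. - A region is a maximal connected set of same-colored vertices. - An island is a region none of whose vertices lies on the outer boundary of the grid. - A vertex $w$ of a region $R$ is disposable if $R\setminus\{w\}$ is empty or induces a connected subgraph. - A cross-structure is a unit square of four vertices $(i,j),(i+1,j),(i,j+1),(i+1,j+1)$ in which $(i,j),(i+1,j+1)$ have one color and $(i+1,j),(i,j+1)$ have the other. Degree of the outer-face vertex. - $v_0^*$ is the vertex of the planar dual corresponding to the outer face. - For a coloring, the degree of $v_0^*$ means the number of dual edges incident to $v_0^*$ whose primal edges have endpoints of different colors. - Equivalently, it is the number of bichromatic primal edges lying on the outer face boundary of the grid. -}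

module Defs where

open import Data.Nat using (ℕ; zero; suc; _+_; _≤_; _≡ᵇ_)
open import Data.Fin using (Fin; toℕ; _≟_)
open import Data.Product using (_×_; _,_; proj₁; proj₂; ∃; ∃-syntax)
open import Data.Sum using (_⊎_)
open import Data.Bool using (Bool; true; false; if_then_else_; _∧_; _∨_; not)
open import Relation.Nullary using (¬_; does)
open import Relation.Binary.PropositionalEquality using (_≡_; _≢_)

data Color : Set where
  red blue : Color

_==ᶜ_ : Color → Color → Bool
red  ==ᶜ red  = true
blue ==ᶜ blue = true
_    ==ᶜ _    = false

Vertex : ℕ → ℕ → Set
Vertex m n = Fin m × Fin n

row : ∀ {m n} → Vertex m n → Fin m
row = proj₁

col : ∀ {m n} → Vertex m n → Fin n
col = proj₂

Coloring : ℕ → ℕ → Set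
Coloring m n = Vertex m n → Color

Adj : ∀ {m n} → Vertex m n → Vertex m n → Set
Adj (i , j) (i' , j') =
  (i ≡ i' × (suc (toℕ j) ≡ toℕ j' ⊎ suc (toℕ j') ≡ toℕ j))
  ⊎ (j ≡ j' × (suc (toℕ i) ≡ toℕ i' ⊎ suc (toℕ i') ≡ toℕ i))

data PathIn {m n} (P : Vertex m n → Set) : Vertex m n → Vertex m n → Set where
  here : ∀ {u} → P u → PathIn P u u
  step : ∀ {u x v} → P u → Adj u x → PathIn P x v → PathIn P u v

-- u lies in the region of v: u has the color of v and they are joined by a
-- path of vertices all of that color (regions = maximal connected monochromatic sets)
SameRegion : ∀ {m n} → Coloring m n → Vertex m n → Vertex m n → Set
SameRegion c v u = c u ≡ c v × PathIn (λ x → c x ≡ c v) v u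

OnBoundary : ∀ {m n} → Vertex m n → Set
OnBoundary {m} {n} (i , j) =
  toℕ i ≡ 0 ⊎ suc (toℕ i) ≡ m ⊎ toℕ j ≡ 0 ⊎ suc (toℕ j) ≡ n

IsIsland : ∀ {m n} → Coloring m n → Vertex m n → Set
IsIsland c v = ∀ u → SameRegion c v u → ¬ OnBoundary u

Disposable : ∀ {m n} → Coloring m n → Vertex m n → Set
Disposable c w =
  ∀ u u' → SameRegion c w u → SameRegion c w u' → u ≢ w → u' ≢ w →
  PathIn (λ x → SameRegion c w x × x ≢ w) u u'

HasCross : ∀ {m n} → Coloring m n → Set
HasCross {m} {n} c =
  ∃[ i ] ∃[ i' ] ∃[ j ] ∃[ j' ]
    (suc (toℕ {m} i) ≡ toℕ i' × suc (toℕ {n} j) ≡ toℕ j'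
     × c (i , j) ≡ c (i' , j') × c (i' , j) ≡ c (i , j') × c (i , j) ≢ c (i' , j))

_≟ᵛ_ : ∀ {m n} → Vertex m n → Vertex m n → Bool
(i , j) ≟ᵛ (i' , j') = does (i ≟ i') ∧ does (j ≟ j')

recolor : ∀ {m n} → Coloring m n → Vertex m n → Color → Coloring m n
recolor c w k x = if x ≟ᵛ w then k else c x

Consecutive : ∀ {m n} → Vertex m n → Vertex m n → Vertex m n → Set
Consecutive (ia , ja) (iw , jw) (ib , jb) =
  (ia ≡ iw × iw ≡ ib ×
    ((suc (toℕ ja) ≡ toℕ jw × suc (toℕ jw) ≡ toℕ jb)
     ⊎ (suc (toℕ jb) ≡ toℕ jw × suc (toℕ jw) ≡ toℕ ja)))
  ⊎ (ja ≡ jw × jw ≡ jb ×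
    ((suc (toℕ ia) ≡ toℕ iw × suc (toℕ iw) ≡ toℕ ib)
     ⊎ (suc (toℕ ib) ≡ toℕ iw × suc (toℕ iw) ≡ toℕ ia)))

sumFin : ∀ k → (Fin k → ℕ) → ℕ
sumFin zero    f = 0
sumFin (suc k) f = f Fin.zero + sumFin k (λ x → f (Fin.suc x))

ind : Bool → ℕ
ind true  = 1
ind false = 0

-- Degree of the outer-face dual vertex v₀*: number of bichromatic grid edges
-- lying on the outer face boundary, each edge counted once.
outerDegree : ∀ {m n} → Coloring m n → ℕ
outerDegree {m} {n} c =
  sumFin m (λ i → sumFin n (λ j → sumFin n (λ j' →
    ind ((toℕ j' ≡ᵇ suc (toℕ j))
         ∧ ((toℕ i ≡ᵇ 0) ∨ (suc (toℕ i) ≡ᵇ m))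
         ∧ not (c (i , j) ==ᶜ c (i , j'))))))
  + sumFin n (λ j → sumFin m (λ i → sumFin m (λ i' →
    ind ((toℕ i' ≡ᵇ suc (toℕ i))
         ∧ ((toℕ j ≡ᵇ 0) ∨ (suc (toℕ j) ≡ᵇ n))
         ∧ not (c (i , j) ==ᶜ c (i' , j))))))

-- Both neighbours of w along the line through a, w, b are red. Every unit square with corner w
-- has one of them as a corner next to w, so after recolouring w red no square at w is a cross.
-- For the same reason w can lie only on a side of the grid parallel to that line, so every outer
-- edge at w joins w to a or b and becomes monochromatic.
--
-- The blue region of w can leave w only through its two other neighbours U and D, so w is
-- disposable once U and D are joined by a blue path avoiding w. Say the region of a is an island.
-- Walk around its boundary, a state being an edge from the region to a blue point: the walk is
-- injective, so it returns to the starting edge a → w. Since there is no cross, consecutive blue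
-- points along the walk are joined by blue paths. The walk meets w only at its start, because b
-- is in another region and U, D are blue. It leaves w towards U and comes back through D, and
-- since the region is an island it never leaves the grid.

module Submission where

open import Defs

open import Data.Bool using (Bool; true; false; T; not; _∧_; _∨_)
open import Data.Bool.Properties using (T-∨)
open import Data.Empty using (⊥-elim)
open import Data.Fin using (Fin; toℕ; fromℕ<)
import Data.Fin as Fin
import Data.Fin.Properties as Fin
open import Data.Integer using (ℤ; +_; -[1+_]; -_; 0ℤ; 1ℤ; -1ℤ)
  renaming (_+_ to _+ℤ_; suc to sucℤ; pred to predℤ)
import Data.Integer.Properties as ℤ
open import Algebra.Properties.AbelianGroup ℤ.+-0-abelianGroup using (\\-leftDividesʳ; ∙-cancelʳ)
open import Algebra.Properties.CommutativeSemigroup ℤ.+-commutativeSemigroup using (x∙yz≈y∙xz)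
open import Data.Maybe using (Maybe; just; nothing)
import Data.Maybe as Maybe
open import Data.Nat using (ℕ; zero; suc; _+_; _*_; _<_; _≤_; _∸_; z≤n; _≡ᵇ_)
open import Data.Nat.GeneralisedArithmetic using (iterate)
import Data.Nat.Properties as ℕ
open import Data.Product using (Σ-syntax; ∃-syntax; _×_; _,_; proj₁; proj₂; uncurry)
import Data.Product.Properties as ×
open import Data.Sum using (_⊎_; inj₁; inj₂)
import Data.Sum as Sum
open import Data.Unit using (tt)
open import Function using (_∘_)
open import Function.Bundles using (Equivalence)
open import Relation.Binary.PropositionalEquality
open import Relation.Nullary using (¬_; Dec; yes; no; contradiction)
open import Relation.Nullary.Decidable using (dec-true)
import Relation.Nullary.Decidable as Dec

data Dir : Set where
  N E S W : Dir

opp : Dir → Dir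
opp N = S
opp E = W
opp S = N
opp W = E

rot : Dir → Dir
rot N = E
rot E = S
rot S = W
rot W = N

rot⁻¹ : Dir → Dir
rot⁻¹ d = opp (rot d)

opp-involutive : ∀ d → opp (opp d) ≡ d
opp-involutive N = refl
opp-involutive E = refl
opp-involutive S = refl
opp-involutive W = refl

opp-injective : ∀ {d d'} → opp d ≡ opp d' → d ≡ d'
opp-injective {d} {d'} h = trans (sym (opp-involutive d)) (trans (cong opp h) (opp-involutive d'))

rot-opp : ∀ d → rot (opp d) ≡ opp (rot d)
rot-opp N = refl
rot-opp E = refl
rot-opp S = refl
rot-opp W = refl

rot-rot : ∀ d → rot (rot d) ≡ opp d
rot-rot N = refl
rot-rot E = refl
rot-rot S = refl
rot-rot W = refl

rot⁻¹-rot : ∀ d → rot⁻¹ (rot d) ≡ d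
rot⁻¹-rot N = refl
rot⁻¹-rot E = refl
rot⁻¹-rot S = refl
rot⁻¹-rot W = refl

rot-rot⁻¹ : ∀ d → rot (rot⁻¹ d) ≡ d
rot-rot⁻¹ N = refl
rot-rot⁻¹ E = refl
rot-rot⁻¹ S = refl
rot-rot⁻¹ W = refl

rot⁻¹-opp-rot : ∀ d → rot⁻¹ (opp (rot d)) ≡ opp d
rot⁻¹-opp-rot N = refl
rot⁻¹-opp-rot E = refl
rot⁻¹-opp-rot S = refl
rot⁻¹-opp-rot W = refl

infix 4 _∥_
_∥_ : Dir → Dir → Set
d ∥ e = d ≡ e ⊎ d ≡ opp e

opp-∥ : ∀ {d e} → d ∥ e → opp d ∥ e
opp-∥ (inj₁ refl) = inj₂ refl
opp-∥ {e = e} (inj₂ refl) = inj₁ (opp-involutive e)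

rot-∥ : ∀ {d e} → d ∥ rot e → rot d ∥ e
rot-∥ {e = e} (inj₁ refl) = inj₂ (rot-rot e)
rot-∥ {e = e} (inj₂ refl) = inj₁ (rot-rot⁻¹ e)

∥-or-∥-rot : ∀ e d → d ∥ e ⊎ d ∥ rot e
∥-or-∥-rot N N = inj₁ (inj₁ refl)
∥-or-∥-rot N E = inj₂ (inj₁ refl)
∥-or-∥-rot N S = inj₁ (inj₂ refl)
∥-or-∥-rot N W = inj₂ (inj₂ refl)
∥-or-∥-rot E N = inj₂ (inj₂ refl)
∥-or-∥-rot E E = inj₁ (inj₁ refl)
∥-or-∥-rot E S = inj₂ (inj₁ refl)
∥-or-∥-rot E W = inj₁ (inj₂ refl)
∥-or-∥-rot S N = inj₁ (inj₂ refl)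
∥-or-∥-rot S E = inj₂ (inj₂ refl)
∥-or-∥-rot S S = inj₁ (inj₁ refl)
∥-or-∥-rot S W = inj₂ (inj₁ refl)
∥-or-∥-rot W N = inj₂ (inj₁ refl)
∥-or-∥-rot W E = inj₁ (inj₂ refl)
∥-or-∥-rot W S = inj₂ (inj₂ refl)
∥-or-∥-rot W W = inj₁ (inj₁ refl)

∥-or-rot-∥ : ∀ e d → d ∥ e ⊎ rot d ∥ e
∥-or-rot-∥ e d = Sum.map₂ rot-∥ (∥-or-∥-rot e d)

dirIndex : Dir → Fin 4
dirIndex N = Fin.zero
dirIndex E = Fin.suc Fin.zero
dirIndex S = Fin.suc (Fin.suc Fin.zero)
dirIndex W = Fin.suc (Fin.suc (Fin.suc Fin.zero))

dirIndex-injective : ∀ {d d'} → dirIndex d ≡ dirIndex d' → d ≡ d'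
dirIndex-injective {d} {d'} h = begin
  d                         ≡⟨ dirIndex⁻¹-dirIndex d ⟨
  dirIndex⁻¹ (dirIndex d)   ≡⟨ cong dirIndex⁻¹ h ⟩
  dirIndex⁻¹ (dirIndex d')  ≡⟨ dirIndex⁻¹-dirIndex d' ⟩
  d'                        ∎
  where
  open ≡-Reasoning
  dirIndex⁻¹ : Fin 4 → Dir
  dirIndex⁻¹ Fin.zero = N
  dirIndex⁻¹ (Fin.suc Fin.zero) = E
  dirIndex⁻¹ (Fin.suc (Fin.suc Fin.zero)) = S
  dirIndex⁻¹ (Fin.suc (Fin.suc (Fin.suc Fin.zero))) = W
  dirIndex⁻¹-dirIndex : ∀ d → dirIndex⁻¹ (dirIndex d) ≡ d
  dirIndex⁻¹-dirIndex N = refl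
  dirIndex⁻¹-dirIndex E = refl
  dirIndex⁻¹-dirIndex S = refl
  dirIndex⁻¹-dirIndex W = refl

_≟ᴰ_ : (d d' : Dir) → Dec (d ≡ d')
d ≟ᴰ d' = Dec.map′ dirIndex-injective (cong dirIndex) (dirIndex d Fin.≟ dirIndex d')

-- Points are (row , column), as grid vertices are: N decreases the row, E increases the column.
Point : Set
Point = ℤ × ℤ

_⊕_ : Point → Point → Point
(x , y) ⊕ (x' , y') = (x +ℤ x' , y +ℤ y')

⊝_ : Point → Point
⊝ (x , y) = (- x , - y)

origin : Point
origin = (0ℤ , 0ℤ)

δ : Dir → Point
δ N = (-1ℤ , 0ℤ)
δ E = (0ℤ , 1ℤ)
δ S = (1ℤ , 0ℤ)
δ W = (0ℤ , -1ℤ)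

-- δ d is added on the left so that moving the position of a vertex computes by evaluation.
move : Point → Dir → Point
move p d = δ d ⊕ p

origin-⊕ : ∀ p → origin ⊕ p ≡ p
origin-⊕ (x , y) = cong₂ _,_ (ℤ.+-identityˡ x) (ℤ.+-identityˡ y)

⊝-cancelˡ : ∀ v p → (⊝ v) ⊕ (v ⊕ p) ≡ p
⊝-cancelˡ (x , y) (x' , y') = cong₂ _,_ (\\-leftDividesʳ x x') (\\-leftDividesʳ y y')

⊕-cancelʳ : ∀ v v' p → v ⊕ p ≡ v' ⊕ p → v ≡ v'
⊕-cancelʳ (x , y) (x' , y') (x'' , y'') h =
  cong₂ _,_ (∙-cancelʳ x'' x x' (cong proj₁ h)) (∙-cancelʳ y'' y y' (cong proj₂ h))

⊕-left-comm : ∀ u v p → u ⊕ (v ⊕ p) ≡ v ⊕ (u ⊕ p)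
⊕-left-comm (x , y) (x' , y') (x'' , y'') = cong₂ _,_ (x∙yz≈y∙xz x x' x'') (x∙yz≈y∙xz y y' y'')

δ-opp : ∀ d → δ (opp d) ≡ ⊝ δ d
δ-opp N = refl
δ-opp E = refl
δ-opp S = refl
δ-opp W = refl

δ-≢-origin : ∀ d → δ d ≢ origin
δ-≢-origin N ()
δ-≢-origin E ()
δ-≢-origin S ()
δ-≢-origin W ()

δ-rot-≢ : ∀ d → δ (rot d) ≢ δ d
δ-rot-≢ N ()
δ-rot-≢ E ()
δ-rot-≢ S ()
δ-rot-≢ W ()

rot-≢ : ∀ d → rot d ≢ d
rot-≢ d h = δ-rot-≢ d (cong δ h)

move-opp : ∀ p d → move (move p d) (opp d) ≡ p
move-opp p d = trans (cong (_⊕ move p d) (δ-opp d)) (⊝-cancelˡ (δ d) p)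

move⁻¹ : ∀ {p q} d → move p d ≡ q → p ≡ move q (opp d)
move⁻¹ {p} d refl = sym (move-opp p d)

move-comm : ∀ p d d' → move (move p d) d' ≡ move (move p d') d
move-comm p d d' = ⊕-left-comm (δ d') (δ d) p

move-around : ∀ p d d' → move (move (move p d) d') (opp d) ≡ move p d'
move-around p d d' = trans (cong (λ q → move q (opp d)) (move-comm p d d')) (move-opp (move p d') d)

move-≢ : ∀ p d → move p d ≢ p
move-≢ p d h = δ-≢-origin d (⊕-cancelʳ (δ d) origin p (trans h (sym (origin-⊕ p))))

move-rot-≢ : ∀ p d → move p (rot d) ≢ move p d
move-rot-≢ p d h = δ-rot-≢ d (⊕-cancelʳ (δ (rot d)) (δ d) p h)

data PlanePath (Q : Point → Set) : Point → Point → Set where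
  here : ∀ {p} → Q p → PlanePath Q p p
  step : ∀ {p q r} d → Q p → q ≡ move p d → PlanePath Q q r → PlanePath Q p r

module _ {Q : Point → Set} where

  PlanePath-head : ∀ {p q} → PlanePath Q p q → Q p
  PlanePath-head (here qp) = qp
  PlanePath-head (step _ qp _ _) = qp

  infixr 5 _++ᵖ_
  _++ᵖ_ : ∀ {p q r} → PlanePath Q p q → PlanePath Q q r → PlanePath Q p r
  here _ ++ᵖ ρ' = ρ'
  step d qp eq ρ ++ᵖ ρ' = step d qp eq (ρ ++ᵖ ρ')

  edgeᵖ : ∀ {p q} d → Q p → Q q → q ≡ move p d → PlanePath Q p q
  edgeᵖ d qp qq eq = step d qp eq (here qq)

-- Orbits of injective maps on finite sets

module _ {A : Set} {P : A → Set} (f : A → A)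
  (f-preserves : ∀ {x} → P x → P (f x))
  (f-injective : ∀ {x y} → P x → P y → f x ≡ f y → x ≡ y) where

  iterate-preserves : ∀ t {x} → P x → P (iterate f x t)
  iterate-preserves zero px = px
  iterate-preserves (suc t) px = iterate-preserves t (f-preserves px)

  iterate-injective : ∀ t {x y} → P x → P y → iterate f x t ≡ iterate f y t → x ≡ y
  iterate-injective zero _ _ h = h
  iterate-injective (suc t) px py h =
    f-injective px py (iterate-injective t (f-preserves px) (f-preserves py) h)

  iterate-+ : ∀ t i x → iterate f x (t + i) ≡ iterate f (iterate f x t) i
  iterate-+ zero i x = refl
  iterate-+ (suc t) i x = iterate-+ t i (f x)

  periodic : ∀ {K} (encode : A → Fin K) → (∀ {x y} → P x → P y → encode x ≡ encode y → x ≡ y) →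
             ∀ {x} → P x → ∃[ t ] iterate f (f x) t ≡ x
  periodic {K} encode encode-injective {x} px
    with i , j , i<j , same ← Fin.pigeonhole (ℕ.n<1+n K) (λ i → encode (iterate f x (toℕ i)))
    with t , 1+i+t≡j ← ℕ.m≤n⇒∃[o]m+o≡n i<j =
    t , sym (iterate-injective (toℕ i) px (iterate-preserves (suc t) px) (begin
      iterate f x (toℕ i)
        ≡⟨ encode-injective (iterate-preserves (toℕ i) px) (iterate-preserves (toℕ j) px) same ⟩
      iterate f x (toℕ j)
        ≡⟨ cong (iterate f x) (trans (sym 1+i+t≡j) (cong suc (ℕ.+-comm (toℕ i) t))) ⟩
      iterate f x (suc t + toℕ i)
        ≡⟨ iterate-+ (suc t) (toℕ i) x ⟩
      iterate f (iterate f x (suc t)) (toℕ i)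
        ∎))
    where open ≡-Reasoning

+toℕ-injective : ∀ {k} {i i' : Fin k} → + toℕ i ≡ + toℕ i' → i ≡ i'
+toℕ-injective h = Fin.toℕ-injective (ℤ.+-injective h)

+≡pred⇒suc≡ : ∀ {i j} → + i ≡ predℤ (+ j) → suc i ≡ j
+≡pred⇒suc≡ {j = j} h = ℤ.+-injective (trans (cong sucℤ h) (ℤ.suc-pred (+ j)))

toℕ∸1< : ∀ {k} (i : Fin k) → toℕ i ∸ 1 < k
toℕ∸1< i = ℕ.≤-<-trans (ℕ.m∸n≤m (toℕ i) 1) (Fin.toℕ<n i)

+[k∸1]≡pred : ∀ {k} → 0 < k → + (k ∸ 1) ≡ predℤ (+ k)
+[k∸1]≡pred {suc k} _ = refl

finAt : ∀ {k} → ℤ → Maybe (Fin k)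
finAt {k} (+ i) with i ℕ.<? k
... | yes i<k = just (fromℕ< i<k)
... | no _ = nothing
finAt -[1+ _ ] = nothing

finAt-toℕ : ∀ {k} (i : Fin k) → finAt (+ toℕ i) ≡ just i
finAt-toℕ {k} i with toℕ i ℕ.<? k
... | yes i<k = cong just (Fin.fromℕ<-toℕ i i<k)
... | no i≮k = contradiction (Fin.toℕ<n i) i≮k

finAt-just : ∀ {k} x {i : Fin k} → finAt x ≡ just i → + toℕ i ≡ x
finAt-just {k} (+ x) h with x ℕ.<? k
finAt-just (+ x) refl | yes x<k = cong +_ (Fin.toℕ-fromℕ< x<k)
finAt-just (+ x) () | no _
finAt-just -[1+ _ ] ()

module _ {m n : ℕ} where

  pos : Vertex m n → Point
  pos (i , j) = (+ toℕ i , + toℕ j)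

  pos-injective : ∀ {v v'} → pos v ≡ pos v' → v ≡ v'
  pos-injective h = cong₂ _,_ (+toℕ-injective (cong proj₁ h)) (+toℕ-injective (cong proj₂ h))

  move⇒Adj : ∀ {v v'} d → pos v' ≡ move (pos v) d → Adj v v'
  move⇒Adj N h = inj₂ (sym (+toℕ-injective (cong proj₂ h)) , inj₂ (+≡pred⇒suc≡ (cong proj₁ h)))
  move⇒Adj E h = inj₁ (sym (+toℕ-injective (cong proj₁ h)) , inj₁ (sym (ℤ.+-injective (cong proj₂ h))))
  move⇒Adj S h = inj₂ (sym (+toℕ-injective (cong proj₂ h)) , inj₁ (sym (ℤ.+-injective (cong proj₁ h))))
  move⇒Adj W h = inj₁ (sym (+toℕ-injective (cong proj₁ h)) , inj₂ (+≡pred⇒suc≡ (cong proj₂ h)))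

  Adj⇒move : ∀ {v v'} → Adj v v' → ∃[ d ] pos v' ≡ move (pos v) d
  Adj⇒move {i , _} (inj₁ (refl , inj₁ h)) = E , cong (λ j → (+ toℕ i , + j)) (sym h)
  Adj⇒move {i , _} (inj₁ (refl , inj₂ h)) = W , cong (λ j → (+ toℕ i , predℤ (+ j))) h
  Adj⇒move {_ , j} (inj₂ (refl , inj₁ h)) = S , cong (λ i → (+ i , + toℕ j)) (sym h)
  Adj⇒move {_ , j} (inj₂ (refl , inj₂ h)) = N , cong (λ i → (predℤ (+ i) , + toℕ j)) h

  Adj-sym : ∀ {v v' : Vertex m n} → Adj v v' → Adj v' v
  Adj-sym (inj₁ (eq , inj₁ h)) = inj₁ (sym eq , inj₂ h)
  Adj-sym (inj₁ (eq , inj₂ h)) = inj₁ (sym eq , inj₁ h)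
  Adj-sym (inj₂ (eq , inj₁ h)) = inj₂ (sym eq , inj₂ h)
  Adj-sym (inj₂ (eq , inj₂ h)) = inj₂ (sym eq , inj₁ h)

  Consecutive⇒move : ∀ {a w b : Vertex m n} → Consecutive a w b →
                     ∃[ e ] pos w ≡ move (pos a) e × pos b ≡ move (pos w) e
  Consecutive⇒move {i , _} (inj₁ (refl , refl , inj₁ (h₁ , h₂))) =
    E , cong (λ j → (+ toℕ i , + j)) (sym h₁) , cong (λ j → (+ toℕ i , + j)) (sym h₂)
  Consecutive⇒move {i , _} (inj₁ (refl , refl , inj₂ (h₁ , h₂))) =
    W , cong (λ j → (+ toℕ i , predℤ (+ j))) h₂ , cong (λ j → (+ toℕ i , predℤ (+ j))) h₁
  Consecutive⇒move {_ , j} (inj₂ (refl , refl , inj₁ (h₁ , h₂))) =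
    S , cong (λ i → (+ i , + toℕ j)) (sym h₁) , cong (λ i → (+ i , + toℕ j)) (sym h₂)
  Consecutive⇒move {_ , j} (inj₂ (refl , refl , inj₂ (h₁ , h₂))) =
    N , cong (λ i → (predℤ (+ i) , + toℕ j)) h₂ , cong (λ i → (predℤ (+ i) , + toℕ j)) h₁

  neighbour-≢ : ∀ {v w : Vertex m n} d → pos v ≡ move (pos w) d → v ≢ w
  neighbour-≢ {w = w} d pv v≡w = move-≢ (pos w) d (trans (sym pv) (cong pos v≡w))

  vertex-≟ : (v v' : Vertex m n) → Dec (v ≡ v')
  vertex-≟ = ×.≡-dec Fin._≟_ Fin._≟_

  module _ {P : Vertex m n → Set} where

    PathIn-head : ∀ {u v} → PathIn P u v → P u
    PathIn-head (here pu) = pu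
    PathIn-head (step pu _ _) = pu

    PathIn-last : ∀ {u v} → PathIn P u v → P v
    PathIn-last (here pv) = pv
    PathIn-last (step _ _ π) = PathIn-last π

    infixr 5 _++_
    _++_ : ∀ {u v x} → PathIn P u v → PathIn P v x → PathIn P u x
    here _ ++ π' = π'
    step pu a π ++ π' = step pu a (π ++ π')

    reverse : ∀ {u v} → PathIn P u v → PathIn P v u
    reverse (here pu) = here pu
    reverse (step pu a π) = reverse π ++ step (PathIn-head π) (Adj-sym a) (here pu)

  PathIn-map : ∀ {P Q : Vertex m n → Set} → (∀ {x} → P x → Q x) → ∀ {u v} → PathIn P u v → PathIn Q u v
  PathIn-map f (here pu) = here (f pu)
  PathIn-map f (step pu a π) = step (f pu) a (PathIn-map f π)

  SameRegion-step : ∀ {c : Coloring m n} {w s x} → SameRegion c w s → Adj s x → c x ≡ c w → SameRegion c w x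
  SameRegion-step (_ , π) a cx = cx , π ++ step (PathIn-last π) a (here cx)

  SameRegion-sym : ∀ {c : Coloring m n} {a b} → SameRegion c a b → SameRegion c b a
  SameRegion-sym (cb , π) = sym cb , PathIn-map (λ cx → trans cx (sym cb)) (reverse π)

  InGrid : Point → Set
  InGrid p = Σ[ v ∈ Vertex m n ] pos v ≡ p

  At : (Vertex m n → Set) → Point → Set
  At R p = Σ[ v ∈ Vertex m n ] pos v ≡ p × R v

  toPathIn : ∀ {R : Vertex m n → Set} {p q u u'} →
             PlanePath (At R) p q → pos u ≡ p → pos u' ≡ q → PathIn R u u'
  toPathIn (here (v , refl , rv)) pu pu'
    with refl ← pos-injective pu | refl ← pos-injective pu' = here rv
  toPathIn (step d (v , refl , rv) refl ρ) pu pu'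
    with refl ← pos-injective pu | v' , pv' , _ ← PlanePath-head ρ = step rv (move⇒Adj d pv') (toPathIn ρ pv' pu')

  vertexAt : Point → Maybe (Vertex m n)
  vertexAt (x , y) = Maybe.zip (finAt x) (finAt y)

  vertexAt-pos : ∀ v → vertexAt (pos v) ≡ just v
  vertexAt-pos (i , j) rewrite finAt-toℕ i | finAt-toℕ j = refl

  -- Off-grid points all get the index of v₀.
  pointIndex : Vertex m n → Point → Fin (m * n)
  pointIndex v₀ p = Maybe.maybe′ (uncurry Fin.combine) (uncurry Fin.combine v₀) (vertexAt p)

  pointIndex-injective : ∀ v₀ {v v'} → pointIndex v₀ (pos v) ≡ pointIndex v₀ (pos v') → v ≡ v'
  pointIndex-injective v₀ {i , j} {i' , j'} h rewrite vertexAt-pos (i , j) | vertexAt-pos (i' , j') =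
    uncurry (cong₂ _,_) (Fin.combine-injective i j i' j' h)

  -- Off-grid points count as blue, so every red point is a vertex.
  colourAt : Coloring m n → Point → Color
  colourAt c p = Maybe.maybe′ c blue (vertexAt p)

  colourAt-pos : ∀ c v → colourAt c (pos v) ≡ c v
  colourAt-pos c v rewrite vertexAt-pos v = refl

  colourAt-red : ∀ c p → colourAt c p ≡ red → At (λ v → c v ≡ red) p
  colourAt-red c (x , y) h with finAt {m} x in ex | finAt {n} y in ey
  ... | just i | just j = (i , j) , cong₂ _,_ (finAt-just x ex) (finAt-just y ey) , h
  ... | just _ | nothing = contradiction h λ ()
  ... | nothing | _ = contradiction h λ ()

  CanMove : Vertex m n → Dir → Set
  CanMove (i , j) N = 0 < toℕ i
  CanMove (i , j) E = suc (toℕ j) < n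
  CanMove (i , j) S = suc (toℕ i) < m
  CanMove (i , j) W = 0 < toℕ j

  moveVertex : ∀ v d → CanMove v d → Vertex m n
  moveVertex (i , j) N _ = (fromℕ< (toℕ∸1< i) , j)
  moveVertex (i , j) E h = (i , fromℕ< h)
  moveVertex (i , j) S h = (fromℕ< h , j)
  moveVertex (i , j) W _ = (i , fromℕ< (toℕ∸1< j))

  moveVertex-pos : ∀ v d h → pos (moveVertex v d h) ≡ move (pos v) d
  moveVertex-pos (i , j) N h = cong (_, + toℕ j) (trans (cong +_ (Fin.toℕ-fromℕ< _)) (+[k∸1]≡pred h))
  moveVertex-pos (i , j) E h = cong (+ toℕ i ,_) (cong +_ (Fin.toℕ-fromℕ< h))
  moveVertex-pos (i , j) S h = cong (_, + toℕ j) (cong +_ (Fin.toℕ-fromℕ< h))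
  moveVertex-pos (i , j) W h = cong (+ toℕ i ,_) (trans (cong +_ (Fin.toℕ-fromℕ< _)) (+[k∸1]≡pred h))

  CanMove-rot : ∀ v d h → CanMove v (rot d) → CanMove (moveVertex v d h) (rot d)
  CanMove-rot v N _ h = h
  CanMove-rot v E _ h = h
  CanMove-rot v S _ h = h
  CanMove-rot v W _ h = h

  interior⇒CanMove : ∀ {v} → ¬ OnBoundary v → ∀ d → CanMove v d
  interior⇒CanMove nb N = ℕ.n≢0⇒n>0 (nb ∘ inj₁)
  interior⇒CanMove {i , _} nb S = ℕ.≤∧≢⇒< (Fin.toℕ<n i) (nb ∘ inj₂ ∘ inj₁)
  interior⇒CanMove {_ , j} nb E = ℕ.≤∧≢⇒< (Fin.toℕ<n j) (nb ∘ inj₂ ∘ inj₂ ∘ inj₂)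
  interior⇒CanMove nb W = ℕ.n≢0⇒n>0 (nb ∘ inj₂ ∘ inj₂ ∘ inj₁)

  neighbour : ∀ {v} → ¬ OnBoundary v → ∀ d → InGrid (move (pos v) d)
  neighbour {v} nb d = moveVertex v d h , moveVertex-pos v d h
    where h = interior⇒CanMove nb d

  diagonal : ∀ {v} → ¬ OnBoundary v → ∀ d → InGrid (move (move (pos v) d) (rot d))
  diagonal {v} nb d =
    moveVertex v' (rot d) h' ,
    trans (moveVertex-pos v' (rot d) h') (cong (λ p → move p (rot d)) (moveVertex-pos v d h))
    where
    h = interior⇒CanMove nb d
    v' = moveVertex v d h
    h' = CanMove-rot v d h (interior⇒CanMove nb (rot d))

  row-interior : ∀ {w : Vertex m n} → InGrid (move (pos w) N) → InGrid (move (pos w) S) →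
                 ¬ (toℕ (row w) ≡ 0 ⊎ suc (toℕ (row w)) ≡ m)
  row-interior (_ , pu) _ (inj₁ i≡0) = ℕ.0≢1+n (trans (sym i≡0) (sym (+≡pred⇒suc≡ (cong proj₁ pu))))
  row-interior _ ((i , _) , pv) (inj₂ 1+i≡m) =
    ℕ.<⇒≢ (subst (_< m) (ℤ.+-injective (cong proj₁ pv)) (Fin.toℕ<n i)) 1+i≡m

  column-interior : ∀ {w : Vertex m n} → InGrid (move (pos w) W) → InGrid (move (pos w) E) →
                    ¬ (toℕ (col w) ≡ 0 ⊎ suc (toℕ (col w)) ≡ n)
  column-interior (_ , pu) _ (inj₁ j≡0) = ℕ.0≢1+n (trans (sym j≡0) (sym (+≡pred⇒suc≡ (cong proj₂ pu))))
  column-interior _ ((_ , j) , pv) (inj₂ 1+j≡n) =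
    ℕ.<⇒≢ (subst (_< n) (ℤ.+-injective (cong proj₂ pv)) (Fin.toℕ<n j)) 1+j≡n

module _ {m n : ℕ} where

  record CrossSquare (c : Coloring m n) (d : Dir) : Set where
    field
      x y z q : Vertex m n
      y-pos : pos y ≡ move (pos x) d
      z-pos : pos z ≡ move (pos x) (rot d)
      q-pos : pos q ≡ move (pos y) (rot d)
      diag : c x ≡ c q
      antidiag : c y ≡ c z
      bichromatic : c x ≢ c y

  module _ {c : Coloring m n} where

    rotate : ∀ {d} → CrossSquare c d → CrossSquare c (rot d)
    rotate {d} sq = record
      { x = y ; y = q ; z = x ; q = z
      ; y-pos = q-pos
      ; z-pos = trans (move⁻¹ d (sym y-pos)) (cong (move (pos y)) (sym (rot-rot d)))
      ; q-pos = trans z-pos′ (cong (move (pos q)) (sym (rot-rot d)))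
      ; diag = antidiag
      ; antidiag = sym diag
      ; bichromatic = λ h → bichromatic (sym (trans h (sym diag)))
      }
      where
      open CrossSquare sq
      open ≡-Reasoning
      z-pos′ : pos z ≡ move (pos q) (opp d)
      z-pos′ = begin
        pos z                                ≡⟨ z-pos ⟩
        move (pos x) (rot d)                 ≡⟨ cong (λ p → move p (rot d)) (move⁻¹ d (sym y-pos)) ⟩
        move (move (pos y) (opp d)) (rot d)  ≡⟨ move-comm (pos y) (opp d) (rot d) ⟩
        move (move (pos y) (rot d)) (opp d)  ≡⟨ cong (λ p → move p (opp d)) q-pos ⟨
        move (pos q) (opp d)                 ∎

    CrossSquare-E⇒HasCross : CrossSquare c E → HasCross c
    CrossSquare-E⇒HasCross record
      { x = i , j ; y = i₁ , j' ; z = i' , j₁ ; q = i₂ , j₂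
      ; y-pos = y-pos ; z-pos = z-pos ; q-pos = q-pos
      ; diag = diag ; antidiag = antidiag ; bichromatic = bichromatic }
      with refl ← +toℕ-injective (cong proj₁ y-pos)
         | refl ← +toℕ-injective (cong proj₂ z-pos)
         | refl ← +toℕ-injective (cong proj₂ q-pos)
      with refl ← +toℕ-injective (trans (cong proj₁ q-pos) (sym (cong proj₁ z-pos))) =
      i , i' , j , j' , ℤ.+-injective (sym (cong proj₁ z-pos)) , ℤ.+-injective (sym (cong proj₂ y-pos)) ,
      diag , sym antidiag , λ h → bichromatic (trans h (sym antidiag))

    CrossSquare⇒HasCross : ∀ d → CrossSquare c d → HasCross c
    CrossSquare⇒HasCross N = CrossSquare-E⇒HasCross ∘ rotate
    CrossSquare⇒HasCross E = CrossSquare-E⇒HasCross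
    CrossSquare⇒HasCross S = CrossSquare-E⇒HasCross ∘ rotate ∘ rotate ∘ rotate
    CrossSquare⇒HasCross W = CrossSquare-E⇒HasCross ∘ rotate ∘ rotate

    HasCross⇒CrossSquare : HasCross c → CrossSquare c E
    HasCross⇒CrossSquare (i , i' , j , j' , 1+i≡i' , 1+j≡j' , diag , antidiag , bichromatic) = record
      { x = i , j ; y = i , j' ; z = i' , j ; q = i' , j'
      ; y-pos = cong (λ k → (+ toℕ i , + k)) (sym 1+j≡j')
      ; z-pos = cong (λ k → (+ k , + toℕ j)) (sym 1+i≡i')
      ; q-pos = cong (λ k → (+ k , + toℕ j')) (sym 1+i≡i')
      ; diag = diag
      ; antidiag = sym antidiag
      ; bichromatic = λ h → bichromatic (trans h (sym antidiag))
      }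

-- Recolouring a vertex flanked by two vertices of the new colour

≢⇒T-not-==ᶜ : ∀ {x y} → x ≢ y → T (not (x ==ᶜ y))
≢⇒T-not-==ᶜ {red} {red} x≢y = x≢y refl
≢⇒T-not-==ᶜ {red} {blue} _ = tt
≢⇒T-not-==ᶜ {blue} {red} _ = tt
≢⇒T-not-==ᶜ {blue} {blue} x≢y = x≢y refl

T-not-==ᶜ⇒≢ : ∀ {x y} → T (not (x ==ᶜ y)) → x ≢ y
T-not-==ᶜ⇒≢ {red} {red} ()
T-not-==ᶜ⇒≢ {red} {blue} _ ()
T-not-==ᶜ⇒≢ {blue} {red} _ ()
T-not-==ᶜ⇒≢ {blue} {blue} ()

T-first-or-last : ∀ {k x} → T ((x ≡ᵇ 0) ∨ (suc x ≡ᵇ k)) → x ≡ 0 ⊎ suc x ≡ k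
T-first-or-last {k} {x} t = Sum.map (ℕ.≡ᵇ⇒≡ x 0) (ℕ.≡ᵇ⇒≡ (suc x) k) (Equivalence.to T-∨ t)

ind-mono : ∀ {a b} → (T a → T b) → ind a ≤ ind b
ind-mono {false} _ = z≤n
ind-mono {true} {true} _ = ℕ.≤-refl
ind-mono {true} {false} f = ⊥-elim (f tt)

sumFin-mono : ∀ k {f g : Fin k → ℕ} → (∀ x → f x ≤ g x) → sumFin k f ≤ sumFin k g
sumFin-mono zero _ = z≤n
sumFin-mono (suc k) f≤g = ℕ.+-mono-≤ (f≤g Fin.zero) (sumFin-mono k (f≤g ∘ Fin.suc))

module _ {m n : ℕ} where

  recolor-self : ∀ c w k → recolor {m} {n} c w k w ≡ k
  recolor-self c (i , j) k rewrite dec-true (i Fin.≟ i) refl | dec-true (j Fin.≟ j) refl = refl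

  recolor-other : ∀ c w k {x} → x ≢ w → recolor {m} {n} c w k x ≡ c x
  recolor-other c (i' , j') k {i , j} x≢w with i Fin.≟ i' | j Fin.≟ j'
  ... | yes refl | yes refl = contradiction refl x≢w
  ... | yes _ | no _ = refl
  ... | no _ | _ = refl

  outer-bichromaticʰ : Coloring m n → Fin m → Fin n → Fin n → Bool
  outer-bichromaticʰ c i j j' =
    (toℕ j' ≡ᵇ suc (toℕ j)) ∧ ((toℕ i ≡ᵇ 0) ∨ (suc (toℕ i) ≡ᵇ m)) ∧ not (c (i , j) ==ᶜ c (i , j'))

  outer-bichromaticᵛ : Coloring m n → Fin n → Fin m → Fin m → Bool
  outer-bichromaticᵛ c j i i' =
    (toℕ i' ≡ᵇ suc (toℕ i)) ∧ ((toℕ j ≡ᵇ 0) ∨ (suc (toℕ j) ≡ᵇ n)) ∧ not (c (i , j) ==ᶜ c (i' , j))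

  record Flanked (c : Coloring m n) (w : Vertex m n) (e : Dir) (k : Color) : Set where
    field
      flank : ∀ d → d ∥ e → At (λ v → c v ≡ k) (move (pos w) d)

  between-flanked : ∀ {c : Coloring m n} {a w b e k} → c a ≡ k → c b ≡ k →
                    pos w ≡ move (pos a) e → pos b ≡ move (pos w) e → Flanked c w e k
  between-flanked {c} {a} {w} {b} {e} {k} ca cb pw pb = record { flank = flank }
    where
    flank : ∀ d → d ∥ e → At (λ v → c v ≡ k) (move (pos w) d)
    flank _ (inj₁ refl) = b , pb , cb
    flank _ (inj₂ refl) = a , move⁻¹ e (sym pw) , ca

  module _ {c : Coloring m n} {w : Vertex m n} {e : Dir} {k : Color} (flanked : Flanked c w e k) where

    private
      c' : Coloring m n
      c' = recolor c w k

    flank-colour : ∀ {v} d → pos v ≡ move (pos w) d → d ∥ e → c v ≡ k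
    flank-colour d pv d∥e with v' , pv' , cv' ← Flanked.flank flanked d d∥e =
      subst (λ u → c u ≡ k) (pos-injective (trans pv' (sym pv))) cv'

    flank-recolour : ∀ {v} d → pos v ≡ move (pos w) d → d ∥ e → c' v ≡ k
    flank-recolour d pv d∥e = trans (recolor-other c w k (neighbour-≢ d pv)) (flank-colour d pv d∥e)

    corner-≢ : ∀ {d} (sq : CrossSquare c' d) → CrossSquare.x sq ≢ w
    corner-≢ {d} sq x≡w = bichromatic (trans c'x≡k (sym c'y≡k))
      where
      open CrossSquare sq
      at-w : ∀ {v} d' → pos v ≡ move (pos x) d' → pos v ≡ move (pos w) d'
      at-w d' pv = trans pv (cong (λ u → move (pos u) d') x≡w)
      c'x≡k : c' x ≡ k
      c'x≡k = trans (cong c' x≡w) (recolor-self c w k)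
      c'y≡k : c' y ≡ k
      c'y≡k with ∥-or-rot-∥ e d
      ... | inj₁ d∥e = flank-recolour d (at-w d y-pos) d∥e
      ... | inj₂ rot-d∥e = trans antidiag (flank-recolour (rot d) (at-w (rot d) z-pos) rot-d∥e)

    CrossSquare-recolor⁻¹ : ∀ {d} (sq : CrossSquare c' d) → let open CrossSquare sq in
                            x ≢ w → y ≢ w → z ≢ w → q ≢ w → CrossSquare c d
    CrossSquare-recolor⁻¹ sq x≢w y≢w z≢w q≢w = record
      { x = x ; y = y ; z = z ; q = q ; y-pos = y-pos ; z-pos = z-pos ; q-pos = q-pos
      ; diag = trans (sym (unchanged x≢w)) (trans diag (unchanged q≢w))
      ; antidiag = trans (sym (unchanged y≢w)) (trans antidiag (unchanged z≢w))
      ; bichromatic = λ h → bichromatic (trans (unchanged x≢w) (trans h (sym (unchanged y≢w))))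
      }
      where
      open CrossSquare sq
      unchanged : ∀ {v} → v ≢ w → c' v ≡ c v
      unchanged = recolor-other c w k

    recolor-flanked-crossFree : ¬ HasCross c → ¬ HasCross c'
    recolor-flanked-crossFree crossFree cross
      with sq ← HasCross⇒CrossSquare cross
      with vertex-≟ (CrossSquare.x sq) w | vertex-≟ (CrossSquare.y sq) w
         | vertex-≟ (CrossSquare.z sq) w | vertex-≟ (CrossSquare.q sq) w
    ... | yes x≡w | _ | _ | _ = corner-≢ sq x≡w
    ... | no _ | yes y≡w | _ | _ = corner-≢ (rotate sq) y≡w
    ... | no _ | no _ | _ | yes q≡w = corner-≢ (rotate (rotate sq)) q≡w
    ... | no _ | no _ | yes z≡w | no _ = corner-≢ (rotate (rotate (rotate sq))) z≡w
    ... | no x≢w | no y≢w | no z≢w | no q≢w =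
      crossFree (CrossSquare⇒HasCross E (CrossSquare-recolor⁻¹ sq x≢w y≢w z≢w q≢w))

    flank-inGrid : ∀ d → d ∥ e → InGrid (move (pos w) d)
    flank-inGrid d d∥e with v , pv , _ ← Flanked.flank flanked d d∥e = v , pv

    flanked-top-or-bottom : toℕ (row w) ≡ 0 ⊎ suc (toℕ (row w)) ≡ m → E ∥ e
    flanked-top-or-bottom extreme with ∥-or-∥-rot e E
    ... | inj₁ E∥e = E∥e
    ... | inj₂ E∥rot-e =
      contradiction extreme (row-interior (flank-inGrid N (opp-∥ S∥e)) (flank-inGrid S S∥e))
      where S∥e = rot-∥ E∥rot-e

    flanked-left-or-right : toℕ (col w) ≡ 0 ⊎ suc (toℕ (col w)) ≡ n → S ∥ e
    flanked-left-or-right extreme with ∥-or-∥-rot e S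
    ... | inj₁ S∥e = S∥e
    ... | inj₂ S∥rot-e =
      contradiction extreme (column-interior (flank-inGrid W W∥e) (flank-inGrid E (opp-∥ W∥e)))
      where W∥e = rot-∥ S∥rot-e

    bichromatic-edge : ∀ {p q} d → pos q ≡ move (pos p) d → ((p ≡ w ⊎ q ≡ w) → d ∥ e) →
                       c' p ≢ c' q → c p ≢ c q
    bichromatic-edge {p} {q} d pq along-e c'p≢c'q with vertex-≟ p w | vertex-≟ q w
    ... | yes refl | _ = λ _ →
      c'p≢c'q (trans (recolor-self c w k) (sym (flank-recolour d pq (along-e (inj₁ refl)))))
    ... | no _ | yes refl = λ _ →
      c'p≢c'q (trans (flank-recolour (opp d) (move⁻¹ d (sym pq)) (opp-∥ (along-e (inj₂ refl))))
                     (sym (recolor-self c w k)))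
    ... | no p≢w | no q≢w = λ cp≡cq →
      c'p≢c'q (trans (recolor-other c w k p≢w) (trans cp≡cq (sym (recolor-other c w k q≢w))))

    boundary-edge-term : ∀ A B {p q} d → (T A → pos q ≡ move (pos p) d) →
                         (T B → (p ≡ w ⊎ q ≡ w) → d ∥ e) →
                         T (A ∧ B ∧ not (c' p ==ᶜ c' q)) → T (A ∧ B ∧ not (c p ==ᶜ c q))
    boundary-edge-term true true d pq along-e t =
      ≢⇒T-not-==ᶜ (bichromatic-edge d (pq tt) (along-e tt) (T-not-==ᶜ⇒≢ t))

    horizontal-term : ∀ i j j' → ind (outer-bichromaticʰ c' i j j') ≤ ind (outer-bichromaticʰ c i j j')
    horizontal-term i j j' = ind-mono (boundary-edge-term (toℕ j' ≡ᵇ suc (toℕ j)) _ E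
      (λ t → cong (λ j″ → (+ toℕ i , + j″)) (ℕ.≡ᵇ⇒≡ _ _ t))
      (λ t ends → flanked-top-or-bottom
        (subst (λ i′ → toℕ i′ ≡ 0 ⊎ suc (toℕ i′) ≡ m) (w-in-row-i ends) (T-first-or-last t))))
      where
      w-in-row-i : (i , j) ≡ w ⊎ (i , j') ≡ w → i ≡ row w
      w-in-row-i = Sum.[ cong row , cong row ]

    vertical-term : ∀ j i i' → ind (outer-bichromaticᵛ c' j i i') ≤ ind (outer-bichromaticᵛ c j i i')
    vertical-term j i i' = ind-mono (boundary-edge-term (toℕ i' ≡ᵇ suc (toℕ i)) _ S
      (λ t → cong (λ i″ → (+ i″ , + toℕ j)) (ℕ.≡ᵇ⇒≡ _ _ t))
      (λ t ends → flanked-left-or-right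
        (subst (λ j′ → toℕ j′ ≡ 0 ⊎ suc (toℕ j′) ≡ n) (w-in-column-j ends) (T-first-or-last t))))
      where
      w-in-column-j : (i , j) ≡ w ⊎ (i' , j) ≡ w → j ≡ col w
      w-in-column-j = Sum.[ cong col , cong col ]

    recolor-flanked-outerDegree : outerDegree c' ≤ outerDegree c
    recolor-flanked-outerDegree = ℕ.+-mono-≤
      (sumFin-mono m λ i → sumFin-mono n λ j → sumFin-mono n (horizontal-term i j))
      (sumFin-mono n λ j → sumFin-mono m λ i → sumFin-mono m (vertical-term j i))

-- Disposability of a blue vertex flanked by red

module _ {m n : ℕ} where

  BlueExcept : Coloring m n → Vertex m n → Vertex m n → Set
  BlueExcept c w x = c x ≡ blue × x ≢ w

  SidesConnected : Coloring m n → Vertex m n → Dir → Set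
  SidesConnected c w e = ∀ {U D} → pos U ≡ move (pos w) (rot e) → pos D ≡ move (pos w) (opp (rot e)) →
                         c U ≡ blue → c D ≡ blue → PathIn (BlueExcept c w) U D

  module _ {c : Coloring m n} {w : Vertex m n} {e : Dir} (cw : c w ≡ blue) (flanked : Flanked c w e red) where

    after-last-visit : ∀ {s t} → PathIn (λ x → c x ≡ c w) s t → t ≢ w →
      PathIn (BlueExcept c w) s t ⊎ Σ[ v ∈ Vertex m n ] Adj w v × PathIn (BlueExcept c w) v t
    after-last-visit (here cs) t≢w = inj₁ (here (trans cs cw , t≢w))
    after-last-visit {s} (step cs a π) t≢w with after-last-visit π t≢w
    ... | inj₂ suffix = inj₂ suffix
    ... | inj₁ π' with vertex-≟ s w
    ...   | yes refl = inj₂ (_ , a , π')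
    ...   | no s≢w = inj₁ (step (trans cs cw , s≢w) a π')

    Side : Vertex m n → Set
    Side v = Σ[ d ∈ Dir ] d ∥ rot e × pos v ≡ move (pos w) d

    region-exit : ∀ {u} → SameRegion c w u → u ≢ w → Σ[ v ∈ Vertex m n ] Side v × PathIn (BlueExcept c w) v u
    region-exit (_ , π) u≢w with after-last-visit π u≢w
    ... | inj₁ π' = contradiction refl (proj₂ (PathIn-head π'))
    ... | inj₂ (v , a , π') with d , pv ← Adj⇒move a with ∥-or-∥-rot e d
    ...   | inj₁ d∥e = contradiction (trans (sym (flank-colour flanked d pv d∥e)) (proj₁ (PathIn-head π'))) λ ()
    ...   | inj₂ d∥rot-e = v , (d , d∥rot-e , pv) , π'

    side-to-side : SidesConnected c w e → ∀ {v v'} → Side v → Side v' → c v ≡ blue → c v' ≡ blue →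
                   PathIn (BlueExcept c w) v v'
    side-to-side _ (_ , inj₁ refl , pv) (_ , inj₁ refl , pv') cv _
      with refl ← pos-injective (trans pv (sym pv')) = here (cv , neighbour-≢ (rot e) pv)
    side-to-side connected (_ , inj₁ refl , pv) (_ , inj₂ refl , pv') cv cv' = connected pv pv' cv cv'
    side-to-side connected (_ , inj₂ refl , pv) (_ , inj₁ refl , pv') cv cv' = reverse (connected pv' pv cv' cv)
    side-to-side _ (_ , inj₂ refl , pv) (_ , inj₂ refl , pv') cv _
      with refl ← pos-injective (trans pv (sym pv')) = here (cv , neighbour-≢ (opp (rot e)) pv)

    into-region : ∀ {s t} → SameRegion c w s → PathIn (BlueExcept c w) s t →
                  PathIn (λ x → SameRegion c w x × x ≢ w) s t
    into-region rs (here (_ , s≢w)) = here (rs , s≢w)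
    into-region rs (step (_ , s≢w) a π) =
      step (rs , s≢w) a (into-region (SameRegion-step rs a (trans (proj₁ (PathIn-head π)) (sym cw))) π)

    flanked-disposable : SidesConnected c w e → Disposable c w
    flanked-disposable connected u u' ru ru' u≢w u'≢w
      with v , side , π ← region-exit ru u≢w | v' , side' , π' ← region-exit ru' u'≢w =
      into-region ru (reverse π ++ side-to-side connected side side' (starts-blue π) (starts-blue π') ++ π')
      where
      starts-blue : ∀ {s t} → PathIn (BlueExcept c w) s t → c s ≡ blue
      starts-blue π = proj₁ (PathIn-head π)

-- Walking around the boundary of a region

module BoundaryWalk {m n : ℕ} (c : Coloring m n) (a : Vertex m n) (ca : c a ≡ red) where

  colour : Point → Color
  colour = colourAt c

  vertex-colour : ∀ {v p k} → pos v ≡ p → colour p ≡ k → c v ≡ k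
  vertex-colour {v} refl h = trans (sym (colourAt-pos c v)) h

  InRegion : Point → Set
  InRegion = At (SameRegion c a)

  InRegion-red : ∀ {p} → InRegion p → colour p ≡ red
  InRegion-red (v , refl , (cv , _)) = trans (colourAt-pos c v) (trans cv ca)

  InRegion-step : ∀ {p q} d → InRegion p → q ≡ move p d → colour q ≡ red → InRegion q
  InRegion-step d (v , refl , rv) q≡ red-q with v' , pv' , cv' ← colourAt-red c _ red-q =
    v' , pv' , SameRegion-step rv (move⇒Adj d (trans pv' q≡)) (trans cv' (sym ca))

  State : Set
  State = Point × Dir

  outside : State → Point
  outside (x , d) = move x d

  record BoundaryEdge (z : State) : Set where
    constructor _,_
    field
      inside : InRegion (proj₁ z)
      outside-blue : colour (outside z) ≡ blue

  -- One step along the boundary, decided by the side point x + r d and the corner x + d + r d.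
  -- With r = rot⁻¹ it retraces the walk made with r = rot.
  turn : (Dir → Dir) → Point → Dir → Color → Color → State
  turn r x d blue _    = (x , r d)
  turn r x d red  blue = (move x (r d) , d)
  turn r x d red  red  = (move (move x d) (r d) , opp (r d))

  walk-step : (Dir → Dir) → State → State
  walk-step r (x , d) = turn r x d (colour (move x (r d))) (colour (move (move x d) (r d)))

  next prev : State → State
  next = walk-step rot
  prev = walk-step rot⁻¹

  walk-step-turn : ∀ r {x d} → colour (move x (r d)) ≡ blue → walk-step r (x , d) ≡ (x , r d)
  walk-step-turn r side rewrite side = refl

  walk-step-straight : ∀ r {x d} → colour (move x (r d)) ≡ red → colour (move (move x d) (r d)) ≡ blue →
                       walk-step r (x , d) ≡ (move x (r d) , d)
  walk-step-straight r side corner rewrite side | corner = refl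

  walk-step-around : ∀ r {x d} → colour (move x (r d)) ≡ red → colour (move (move x d) (r d)) ≡ red →
                     walk-step r (x , d) ≡ (move (move x d) (r d) , opp (r d))
  walk-step-around r side corner rewrite side | corner = refl

  prev-turn : ∀ {x d} → colour (move x d) ≡ blue → prev (x , rot d) ≡ (x , d)
  prev-turn {x} {d} y-blue =
    trans (walk-step-turn rot⁻¹ (trans (cong (λ k → colour (move x k)) (rot⁻¹-rot d)) y-blue))
          (cong (x ,_) (rot⁻¹-rot d))

  prev-straight : ∀ {x d} → colour x ≡ red → colour (move x d) ≡ blue → prev (move x (rot d) , d) ≡ (x , d)
  prev-straight {x} {d} x-red y-blue =
    trans (walk-step-straight rot⁻¹ (trans (cong colour (move-opp x (rot d))) x-red)
                                    (trans (cong colour (move-around x (rot d) d)) y-blue))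
          (cong (_, d) (move-opp x (rot d)))

  prev-around : ∀ {x d} → colour x ≡ red → colour (move x (rot d)) ≡ red →
                prev (move (move x d) (rot d) , opp (rot d)) ≡ (x , d)
  prev-around {x} {d} x-red side-red =
    trans (walk-step-around rot⁻¹ (trans (cong (λ k → colour (move q k)) (rot⁻¹-opp-rot d))
                                         (trans (cong colour (move-around x d (rot d))) side-red))
                                  (trans (cong colour back-at-x) x-red))
          (cong₂ _,_ back-at-x (trans (cong opp (rot⁻¹-opp-rot d)) (opp-involutive d)))
    where
    open ≡-Reasoning
    q = move (move x d) (rot d)
    back-at-x : move (move q (opp (rot d))) (rot⁻¹ (opp (rot d))) ≡ x
    back-at-x = begin
      move (move q (opp (rot d))) (rot⁻¹ (opp (rot d)))
        ≡⟨ cong (move (move q (opp (rot d)))) (rot⁻¹-opp-rot d) ⟩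
      move (move q (opp (rot d))) (opp d)
        ≡⟨ cong (λ p → move p (opp d)) (move-opp (move x d) (rot d)) ⟩
      move (move x d) (opp d)
        ≡⟨ move-opp x d ⟩
      x ∎

  prev-next : ∀ {z} → BoundaryEdge z → prev (next z) ≡ z
  prev-next {x , d} (x∈R , y-blue)
    with colour (move x (rot d)) in side | colour (move (move x d) (rot d)) in corner
  ... | blue | _    = prev-turn y-blue
  ... | red  | blue = prev-straight (InRegion-red x∈R) y-blue
  ... | red  | red  = prev-around (InRegion-red x∈R) side

  next-injective : ∀ {z z'} → BoundaryEdge z → BoundaryEdge z' → next z ≡ next z' → z ≡ z'
  next-injective ez ez' h = trans (sym (prev-next ez)) (trans (cong prev h) (prev-next ez'))

  next-preserves : ∀ {z} → BoundaryEdge z → BoundaryEdge (next z)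
  next-preserves {x , d} (x∈R , y-blue)
    with colour (move x (rot d)) in side | colour (move (move x d) (rot d)) in corner
  ... | blue | _    = x∈R , side
  ... | red  | blue = InRegion-step (rot d) x∈R refl side , trans (cong colour (move-comm x (rot d) d)) corner
  ... | red  | red  = InRegion-step d (InRegion-step (rot d) x∈R refl side) (move-comm x d (rot d)) corner ,
                      trans (cong colour (move-opp (move x d) (rot d))) y-blue

  encode : State → Fin ((m * n) * 4)
  encode (x , d) = Fin.combine (pointIndex a x) (dirIndex d)

  encode-injective : ∀ {z z'} → BoundaryEdge z → BoundaryEdge z' → encode z ≡ encode z' → z ≡ z'
  encode-injective ((v , refl , _) , _) ((v' , refl , _) , _) h
    with same-point , same-dir ← Fin.combine-injective _ _ _ _ h =
    cong₂ _,_ (cong pos (pointIndex-injective a same-point)) (dirIndex-injective same-dir)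

  returns : ∀ {z} → BoundaryEdge z → ∃[ t ] iterate next (next z) t ≡ z
  returns = periodic next next-preserves next-injective encode encode-injective

-- Around an island next to w

red≢blue : red ≢ blue
red≢blue ()

module SidesAroundIsland {m n : ℕ} {c : Coloring m n} {a w b : Vertex m n} {e : Dir}
  (crossFree : ¬ HasCross c) (ca : c a ≡ red) (cw : c w ≡ blue) (cb : c b ≡ red)
  (pw : pos w ≡ move (pos a) e) (pb : pos b ≡ move (pos w) e)
  (apart : ¬ SameRegion c a b) (island : IsIsland c a)
  {U D : Vertex m n} (pU : pos U ≡ move (pos w) (rot e)) (pD : pos D ≡ move (pos w) (opp (rot e)))
  (cU : c U ≡ blue) (cD : c D ≡ blue) where

  open BoundaryWalk c a ca

  Free : Point → Set
  Free = At (BlueExcept c w)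

  free-at : ∀ {p} → InGrid {m} {n} p → colour p ≡ blue → p ≢ pos w → Free p
  free-at (v , pv) blue-p p≢w = v , pv , vertex-colour pv blue-p , λ v≡w → p≢w (trans (sym pv) (cong pos v≡w))

  U-free : Free (pos U)
  U-free = U , refl , cU , neighbour-≢ (rot e) pU

  D-free : Free (pos D)
  D-free = D , refl , cD , neighbour-≢ (opp (rot e)) pD

  region-red : ∀ {v} → SameRegion c a v → c v ≡ red
  region-red (cv , _) = trans cv ca

  region-neighbour : ∀ {x} → InRegion x → ∀ d → InGrid {m} {n} (move x d)
  region-neighbour (v , refl , rv) = neighbour (island v rv)

  region-diagonal : ∀ {x} → InRegion x → ∀ d → InGrid {m} {n} (move (move x d) (rot d))
  region-diagonal (v , refl , rv) = diagonal (island v rv)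

  flank-red : ∀ {k} → k ∥ e → colour (move (pos w) k) ≡ red
  flank-red k∥e with v , pv , cv ← Flanked.flank (between-flanked ca cb pw pb) _ k∥e =
    trans (cong colour (sym pv)) (trans (colourAt-pos c v) cv)

  side-blue : ∀ {v k} → k ∥ rot e → pos v ≡ move (pos w) k → c v ≡ blue
  side-blue (inj₁ refl) pv = subst (λ u → c u ≡ blue) (pos-injective (trans pU (sym pv))) cU
  side-blue (inj₂ refl) pv = subst (λ u → c u ≡ blue) (pos-injective (trans pD (sym pv))) cD

  region-next-to-w : ∀ {v k} → SameRegion c a v → pos v ≡ move (pos w) k → v ≡ a × k ≡ opp e
  region-next-to-w {k = k} rv pv with ∥-or-∥-rot e k
  ... | inj₁ (inj₁ refl) = contradiction (subst (SameRegion c a) (pos-injective (trans pv (sym pb))) rv) apart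
  ... | inj₁ (inj₂ refl) = pos-injective (trans pv (sym (move⁻¹ e (sym pw)))) , refl
  ... | inj₂ k∥rot-e = ⊥-elim (red≢blue (trans (sym (region-red rv)) (side-blue k∥rot-e pv)))

  start : State
  start = (pos a , e)

  start-edge : BoundaryEdge start
  start-edge = (a , refl , refl , here refl) , trans (cong colour (sym pw)) (trans (colourAt-pos c w) cw)

  outside-at-w : ∀ {z} → BoundaryEdge z → outside z ≡ pos w → z ≡ start
  outside-at-w {_ , d} ((_ , refl , rv) , _) y≡w
    with refl , opp-d≡opp-e ← region-next-to-w rv (move⁻¹ d y≡w) = cong (pos a ,_) (opp-injective opp-d≡opp-e)

  outside-free : ∀ {z} → BoundaryEdge z → z ≢ start → Free (outside z)
  outside-free {x , d} edge@(x∈R , y-blue) z≢start =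
    free-at (region-neighbour x∈R d) y-blue (λ y≡w → z≢start (outside-at-w edge y≡w))

  corner-≢-w : ∀ {x d} → colour (move x d) ≡ blue → colour (move x (rot d)) ≡ blue →
               move (move x d) (rot d) ≢ pos w
  corner-≢-w {x} {d} y-blue side-blue′ q≡w with ∥-or-rot-∥ e (opp d)
  ... | inj₁ opp-d∥e = red≢blue (begin
    red                           ≡⟨ flank-red opp-d∥e ⟨
    colour (move (pos w) (opp d)) ≡⟨ cong colour (move⁻¹ d (trans (move-comm x (rot d) d) q≡w)) ⟨
    colour (move x (rot d))       ≡⟨ side-blue′ ⟩
    blue                          ∎)
    where open ≡-Reasoning
  ... | inj₂ rot-opp-d∥e = red≢blue (begin
    red                                 ≡⟨ flank-red (subst (_∥ e) (rot-opp d) rot-opp-d∥e) ⟨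
    colour (move (pos w) (opp (rot d))) ≡⟨ cong colour (move⁻¹ (rot d) q≡w) ⟨
    colour (move x d)                   ≡⟨ y-blue ⟩
    blue                                ∎)
    where open ≡-Reasoning

  diagonal-cross : ∀ {x d} → InRegion x → colour (move x d) ≡ blue → colour (move x (rot d)) ≡ blue →
                   colour (move (move x d) (rot d)) ≡ red → HasCross c
  diagonal-cross {d = d} x∈R@(v , refl , rv) y-blue side-blue′ corner-red = CrossSquare⇒HasCross d record
    { x = v ; y = proj₁ y ; z = proj₁ z ; q = proj₁ q
    ; y-pos = proj₂ y ; z-pos = proj₂ z
    ; q-pos = trans (proj₂ q) (cong (λ p → move p (rot d)) (sym (proj₂ y)))
    ; diag = trans (region-red rv) (sym (vertex-colour (proj₂ q) corner-red))
    ; antidiag = trans (vertex-colour (proj₂ y) y-blue) (sym (vertex-colour (proj₂ z) side-blue′))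
    ; bichromatic = λ h → red≢blue (trans (sym (region-red rv)) (trans h (vertex-colour (proj₂ y) y-blue)))
    }
    where
    y = region-neighbour x∈R d
    z = region-neighbour x∈R (rot d)
    q = region-diagonal x∈R d

  step-path : ∀ {z} → BoundaryEdge z → Free (outside z) → Free (outside (next z)) →
              PlanePath Free (outside z) (outside (next z))
  step-path {x , d} (x∈R , y-blue) y-free y′-free
    with colour (move x (rot d)) in side | colour (move (move x d) (rot d)) in corner
  ... | blue | blue =
    edgeᵖ (rot d) y-free q-free refl ++ᵖ edgeᵖ (opp d) q-free y′-free (sym (move-around x d (rot d)))
    where q-free = free-at (region-diagonal x∈R d) corner (corner-≢-w {x} {d} y-blue side)
  ... | blue | red = ⊥-elim (crossFree (diagonal-cross {d = d} x∈R y-blue side corner))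
  ... | red | blue = edgeᵖ (rot d) y-free y′-free (move-comm x (rot d) d)
  ... | red | red = subst (PlanePath Free (move x d)) (sym (move-opp (move x d) (rot d))) (here y-free)

  corner-at-U : move (move (pos a) e) (rot e) ≡ pos U
  corner-at-U = trans (cong (λ p → move p (rot e)) (sym pw)) (sym pU)

  first-step : PlanePath Free (pos U) (outside (next start)) × next start ≢ start
  first-step with colour (move (pos a) (rot e)) in side | colour (move (move (pos a) e) (rot e)) in corner
  ... | blue | _ =
    edgeᵖ (opp e) U-free side-free
          (trans (sym (move-around (pos a) e (rot e))) (cong (λ p → move p (opp e)) corner-at-U)) ,
    λ h → rot-≢ e (cong proj₂ h)
    where side-free = free-at (region-neighbour (BoundaryEdge.inside start-edge) (rot e)) side
                              (λ h → move-rot-≢ (pos a) e (trans h pw))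
  ... | red | blue =
    subst (PlanePath Free (pos U)) (sym (trans (move-comm (pos a) (rot e) e) corner-at-U)) (here U-free) ,
    λ h → move-≢ (pos a) (rot e) (cong proj₁ h)
  ... | red | red =
    ⊥-elim (red≢blue (trans (sym corner) (trans (cong colour corner-at-U) (trans (colourAt-pos c U) cU))))

  D-from-a : pos D ≡ move (move (pos a) (opp (rot e))) e
  D-from-a = trans pD (trans (cong (λ p → move p (opp (rot e))) pw) (move-comm (pos a) e (opp (rot e))))

  last-step : ∀ {z} → BoundaryEdge z → z ≢ start → Free (outside z) → next z ≡ start →
              PlanePath Free (outside z) (pos D)
  last-step {x , d} edge z≢start y-free
    with colour (move x (rot d)) in side | colour (move (move x d) (rot d)) in corner
  ... | blue | _ = λ h → edgeᵖ e y-free D-free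
    (trans D-from-a (cong₂ (λ p k → move (move p k) e) (sym (cong proj₁ h)) (sym (d≡opp-rot-e h))))
    where d≡opp-rot-e : (x , rot d) ≡ start → d ≡ opp (rot e)
          d≡opp-rot-e h = trans (sym (rot⁻¹-rot d)) (cong rot⁻¹ (cong proj₂ h))
  ... | red | blue = λ h → subst (PlanePath Free (move x d)) (y≡D h) (here y-free)
    where y≡D : (move x (rot d) , d) ≡ start → move x d ≡ pos D
          y≡D h with refl ← cong proj₂ h =
            trans (cong (λ p → move p e) (move⁻¹ (rot e) (cong proj₁ h))) (sym D-from-a)
  ... | red | red = λ h → contradiction (outside-at-w edge (y≡w h)) z≢start
    where y≡w : (move (move x d) (rot d) , opp (rot d)) ≡ start → move x d ≡ pos w
          y≡w h = trans (move⁻¹ (rot d) (cong proj₁ h)) (trans (cong (move (pos a)) (cong proj₂ h)) (sym pw))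

  state-≟ : (z z' : State) → Dec (z ≡ z')
  state-≟ = ×.≡-dec (×.≡-dec ℤ._≟_ ℤ._≟_) _≟ᴰ_

  walk-to-D : ∀ t {z} → BoundaryEdge z → z ≢ start → PlanePath Free (pos U) (outside z) →
              iterate next z t ≡ start → PlanePath Free (pos U) (pos D)
  walk-to-D zero _ z≢start _ z≡start = contradiction z≡start z≢start
  walk-to-D (suc t) {z} edge z≢start ρ returned with state-≟ (next z) start
  ... | yes nz≡start = ρ ++ᵖ last-step edge z≢start (outside-free edge z≢start) nz≡start
  ... | no nz≢start = walk-to-D t (next-preserves edge) nz≢start (ρ ++ᵖ onward) returned
    where onward = step-path edge (outside-free edge z≢start) (outside-free (next-preserves edge) nz≢start)

  U-to-D : PathIn (BlueExcept c w) U D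
  U-to-D with t , returned ← returns start-edge =
    toPathIn (walk-to-D t (next-preserves start-edge) (proj₂ first-step) (proj₁ first-step) returned) refl refl

island-sides-connected : ∀ {m n} {c : Coloring m n} {a w b} e →
  ¬ HasCross c → c a ≡ red → c w ≡ blue → c b ≡ red →
  pos w ≡ move (pos a) e → pos b ≡ move (pos w) e → ¬ SameRegion c a b →
  IsIsland c a ⊎ IsIsland c b → SidesConnected c w e
island-sides-connected e crossFree ca cw cb pw pb apart (inj₁ island) pU pD cU cD =
  SidesAroundIsland.U-to-D {e = e} crossFree ca cw cb pw pb apart island pU pD cU cD
-- Seen from b the direction is opp e, which exchanges the sides of U and D.
island-sides-connected {w = w} e crossFree ca cw cb pw pb apart (inj₂ island) pU pD cU cD =
  reverse (SidesAroundIsland.U-to-D {e = opp e} crossFree cb cw ca (move⁻¹ e (sym pb)) (move⁻¹ e (sym pw))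
                                    (apart ∘ SameRegion-sym) island pD′ pU′ cD cU)
  where
  pD′ = trans pD (cong (move (pos w)) (sym (rot-opp e)))
  pU′ = trans pU (cong (move (pos w)) (sym (trans (cong opp (rot-opp e)) (opp-involutive (rot e)))))

lemma21 : (m n : ℕ) (c : Coloring m n) (a w b : Vertex m n) →
    ¬ HasCross c →
    Consecutive a w b →
    c a ≡ red → c b ≡ red → c w ≡ blue →
    ¬ SameRegion c a b →
    (IsIsland c a ⊎ IsIsland c b) →
    Disposable c w
      × ¬ HasCross (recolor c w red)
      × outerDegree (recolor c w red) ≤ outerDegree c
lemma21 m n c a w b crossFree consecutive ca cb cw apart islands
  with e , pw , pb ← Consecutive⇒move consecutive =
  flanked-disposable cw flanked (island-sides-connected e crossFree ca cw cb pw pb apart islands) ,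
  recolor-flanked-crossFree flanked crossFree ,
  recolor-flanked-outerDegree flanked
  where
  flanked : Flanked c w e red
  flanked = between-flanked ca cb pw pb
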